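{- Let $N=(S,T,F,M_0,\ell)$ be a plain structural conflict net. If $N$ has a fully reachable pure M, then there are $\sigma\in\mathrm{Act}^*$ and $a,b,c\in\mathrm{Act}$ with $a\ne c$ such that $\langle\sigma,\{\{a,c\}\}\rangle\notin\mathcal F(N)$, $\langle\sigma,\{\{b\}\}\rangle\notin\mathcal F(N)$ and $\langle\sigma,\{\{a,b\},\{b,c\}\}\rangle\in\mathcal F(N)$ (which implies $a\ne b\ne c$).
   Context: Fix $\mathrm{Act}$, $\tau\notin\mathrm{Act}$. Petri net $N=(S,T,F,M_0,\ell)$, $\ell:T\to\mathrm{Act}\cup\{\tau\}$; ${}^\bullet x(y)=F(y,x)$; $M[G\rangle M'$ iff ${}^\bullet G\le M$, $M'=M-{}^\bullet G+G^\bullet$; $t\smile u$ iff some reachable marking enables $\{t\}+\{u\}$. Structural conflict net: $t\smile u\Rightarrow{}^\bullet t\cap{}^\bullet u=\emptyset$. Plain: $\ell$ injective, no $\tau$ labels. Fully reachable pure M: $t,u,v\in T$ with ${}^\bullet t\cap{}^\bullet u\ne\emptyset$, ${}^\bullet u\cap{}^\bullet v\ne\emptyset$, ${}^\bullet t\cap{}^\bullet v=\emptyset$ and a reachable $M\ge{}^\bullet t\cup{}^\bullet u\cup{}^\bullet v$. Step failures: $M\xrightarrow{a}M'$ iff $M[t\rangle M'$ with $\ell(t)=a$; $\Rightarrow$ reflexive transitive closure of $\xrightarrow{\tau}$; $M\stackrel{a_1\cdots a_n}{\Longrightarrow}M'$ means $M\Rightarrow\xrightarrow{a_1}\Rightarrow\cdots\xrightarrow{a_n}\Rightarrow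 M'$; for a nonempty finite multiset $A$ over $\mathrm{Act}$, $M\xrightarrow{A}$ iff $M[G\rangle$ for some $G$ with $\ell(G)=A$. $\mathcal F(N)$ is the set of pairs $\langle\sigma,X\rangle$ ($\sigma\in\mathrm{Act}^*$, $X$ finite set of nonempty finite multisets over $\mathrm{Act}$) such that some $M$ has $M_0\stackrel{\sigma}{\Longrightarrow}M$, $M\not\xrightarrow{\tau}$ and $M\not\xrightarrow{A}$ for all $A\in X$. -}

module Defs where

open import Data.Nat using (ℕ; _+_; _∸_; _≤_; _<_; _⊔_)
open import Data.List using (List; []; _∷_; map)
open import Data.List.Relation.Unary.All using (All)
open import Data.List.Relation.Binary.Permutation.Propositional using (_↭_)
open import Data.Maybe using (Maybe; just; nothing)
open import Data.Product using (Σ; ∃; _×_; _,_)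
open import Relation.Binary.PropositionalEquality using (_≡_; _≢_)
open import Relation.Nullary using (¬_)

-- Labels: just a  is an action a ∈ Act,  nothing  is τ.
τ : {Act : Set} → Maybe Act
τ = nothing

-- A Petri net N = (S, T, F, M₀, ℓ).  The flow function F is split into
-- pre s t = F(s,t)  and  post t s = F(t,s).  Markings are multisets S → ℕ.
record Net (Act : Set) : Set₁ where
  field
    S    : Set
    T    : Set
    pre  : S → T → ℕ
    post : T → S → ℕ
    M₀   : S → ℕ
    ℓ    : T → Maybe Act

module _ {Act : Set} (N : Net Act) where
  open Net N

  Marking : Set
  Marking = S → ℕ

  -- finite multisets over T are represented as lists (order irrelevant)
  -- ᵒG (s) = Σ_{t∈G} F(s,t)   (preset of a multiset of transitions)
  preG : List T → S → ℕ
  preG []      s = 0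
  preG (t ∷ G) s = pre s t + preG G s

  postG : List T → S → ℕ
  postG []      s = 0
  postG (t ∷ G) s = post t s + postG G s

  _≤ₘ_ : Marking → Marking → Set
  M ≤ₘ M' = ∀ s → M s ≤ M' s

  Enabled : Marking → List T → Set
  Enabled M G = preG G ≤ₘ M

  Fires : Marking → List T → Marking → Set
  Fires M G M' = Enabled M G × (∀ s → M' s ≡ (M s ∸ preG G s) + postG G s)

  data Reachable : Marking → Set where
    init : Reachable M₀
    step : ∀ {M G M'} → Reachable M → Fires M G M' → Reachable M'

  Concurrent : T → T → Set
  Concurrent t u = ∃ λ M → Reachable M × Enabled M (t ∷ u ∷ [])

  PresetsOverlap : T → T → Set
  PresetsOverlap t u = ∃ λ s → (0 < pre s t) × (0 < pre s u)

  StructuralConflict : Set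
  StructuralConflict = ∀ t u → Concurrent t u → ¬ PresetsOverlap t u

  Plain : Set
  Plain = (∀ t u → ℓ t ≡ ℓ u → t ≡ u) × (∀ t → ℓ t ≢ τ)

  -- fully reachable pure M  (ᵒt ∪ ᵒu ∪ ᵒv is multiset union = pointwise max)
  FullyReachablePureM : Set
  FullyReachablePureM =
    Σ T λ t → Σ T λ u → Σ T λ v →
      PresetsOverlap t u × PresetsOverlap u v × ¬ PresetsOverlap t v ×
      (∃ λ M → Reachable M × (∀ s → (pre s t ⊔ pre s u) ⊔ pre s v ≤ M s))

  LStep : Marking → Maybe Act → Marking → Set
  LStep M α M' = Σ T λ t → ℓ t ≡ α × Fires M (t ∷ []) M'

  data TauStar : Marking → Marking → Set where
    done : ∀ {M} → TauStar M M
    more : ∀ {M M₁ M'} → LStep M τ M₁ → TauStar M₁ M' → TauStar M M'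

  data Weak : Marking → List Act → Marking → Set where
    nil  : ∀ {M M'} → TauStar M M' → Weak M [] M'
    cons : ∀ {M M₁ M₂ M' a σ} → TauStar M M₁ → LStep M₁ (just a) M₂ →
           Weak M₂ σ M' → Weak M (a ∷ σ) M'

  CanStep : Marking → List Act → Set
  CanStep M A = ∃ λ G → Enabled M G × (map ℓ G ↭ map just A)

  -- ⟨σ, X⟩ ∈ 𝓕(N); X is a finite set of (nonempty) multisets given as a list
  InFailures : List Act → List (List Act) → Set
  InFailures σ X = ∃ λ M → Weak M₀ σ M × (¬ ∃ λ M' → LStep M τ M') ×
                   All (λ A → ¬ CanStep M A) X

-- In a plain net there are no τ-moves and a label determines its transition, so
-- every trace σ leads to a unique marking, and every reachable marking is the
-- marking after some trace.  Take σ leading to the marking M of the pure M.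
-- There u alone is enabled, and so are t and v together since their presets are
-- disjoint; hence {b} and {a,c} are not refused after σ.  But in a structural
-- conflict net no reachable marking enables a step of two transitions with
-- overlapping presets, so {a,b} and {b,c} are refused.
module Submission where

open import Defs
open import Data.Empty using (⊥; ⊥-elim)
open import Data.List using (List; []; _∷_; _++_; map)
open import Data.List.Membership.Propositional using (_∈_)
open import Data.List.Relation.Binary.Permutation.Propositional using (↭-reflexive)
open import Data.List.Relation.Binary.Permutation.Propositional.Properties using (∈-resp-↭; ↭-length)
open import Data.List.Relation.Unary.All as All using (All; []; _∷_)
open import Data.List.Relation.Unary.Any using (here; there)
open import Data.Maybe using (just; nothing)
open import Data.Nat using (zero; suc; _+_; _∸_; _≤_; _<_; _⊔_; z≤n; s≤s)
open import Data.Nat.Properties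
open import Data.Product using (Σ; ∃; _×_; _,_; proj₁; proj₂)
open import Data.Sum using (_⊎_; inj₁; inj₂)
open import Function using (_∘_)
open import Relation.Binary.PropositionalEquality
open import Relation.Nullary using (¬_)

∸-+-split : ∀ m p q a b → p + q ≤ m → (m ∸ (p + q)) + (a + b) ≡ ((m ∸ p) + a ∸ q) + b
∸-+-split m p q a b p+q≤m = begin
  (m ∸ (p + q)) + (a + b)  ≡⟨ +-assoc (m ∸ (p + q)) a b ⟨
  (m ∸ (p + q)) + a + b    ≡⟨ cong (λ k → k + a + b) (∸-+-assoc m p q) ⟨
  (m ∸ p ∸ q) + a + b      ≡⟨ cong (_+ b) (+-∸-comm a q≤m∸p) ⟨
  ((m ∸ p) + a ∸ q) + b    ∎
  where
  open ≡-Reasoning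
  q≤m∸p : q ≤ m ∸ p
  q≤m∸p = m+n≤o⇒m≤o∸n q (subst (_≤ m) (+-comm p q) p+q≤m)

+-≤-disjoint : ∀ m n o → (0 < m → 0 < n → ⊥) → m ≤ o → n ≤ o → m + n ≤ o
+-≤-disjoint zero    n       o _        _   n≤o = n≤o
+-≤-disjoint (suc m) zero    o _        m≤o _   = subst (_≤ o) (sym (+-identityʳ (suc m))) m≤o
+-≤-disjoint (suc m) (suc n) o disjoint _   _   = ⊥-elim (disjoint (s≤s z≤n) (s≤s z≤n))

module _ {Act : Set} (N : Net Act) where
  open Net N

  preG-++ : ∀ G H s → preG N (G ++ H) s ≡ preG N G s + preG N H s
  preG-++ []      H s = refl
  preG-++ (t ∷ G) H s = trans (cong (pre s t +_) (preG-++ G H s)) (sym (+-assoc (pre s t) _ _))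

  postG-++ : ∀ G H s → postG N (G ++ H) s ≡ postG N G s + postG N H s
  postG-++ []      H s = refl
  postG-++ (t ∷ G) H s = trans (cong (post t s +_) (postG-++ G H s)) (sym (+-assoc (post t s) _ _))

  Enabled-resp-≗ : ∀ {M M' G} → M ≗ M' → Enabled N M G → Enabled N M' G
  Enabled-resp-≗ M≗M' en s = subst (_ ≤_) (M≗M' s) (en s)

  Fires-respˡ-≗ : ∀ {M M' G M''} → M ≗ M' → Fires N M G M'' → Fires N M' G M''
  Fires-respˡ-≗ {G = G} M≗M' (en , eq) =
    Enabled-resp-≗ {G = G} M≗M' en ,
    λ s → trans (eq s) (cong (λ k → (k ∸ preG N G s) + postG N G s) (M≗M' s))

  Fires-deterministic : ∀ {M₁ M₂ G M₁' M₂'} → M₁ ≗ M₂ →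
                        Fires N M₁ G M₁' → Fires N M₂ G M₂' → M₁' ≗ M₂'
  Fires-deterministic {G = G} M₁≗M₂ (_ , eq₁) (_ , eq₂) s =
    trans (eq₁ s) (trans (cong (λ k → (k ∸ preG N G s) + postG N G s) (M₁≗M₂ s)) (sym (eq₂ s)))

  CanStep-resp-≗ : ∀ {M M' A} → M ≗ M' → CanStep N M A → CanStep N M' A
  CanStep-resp-≗ M≗M' (G , en , ℓG↭A) = G , Enabled-resp-≗ {G = G} M≗M' en , ℓG↭A

  Fires-++ : ∀ {M M'} G H → Fires N M (G ++ H) M' →
             let M₁ = λ s → (M s ∸ preG N G s) + postG N G s
             in Fires N M G M₁ × Fires N M₁ H M'
  Fires-++ {M} {M'} G H (en , eq) = (enG , λ s → refl) , enH , eqH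
    where
    total≤M : ∀ s → preG N G s + preG N H s ≤ M s
    total≤M s = subst (_≤ M s) (preG-++ G H s) (en s)
    enG : Enabled N M G
    enG s = m+n≤o⇒m≤o (preG N G s) (total≤M s)
    enH : Enabled N (λ s → (M s ∸ preG N G s) + postG N G s) H
    enH s = ≤-trans (m+n≤o⇒m≤o∸n (preG N H s) (subst (_≤ M s) (+-comm (preG N G s) _) (total≤M s)))
                    (m≤m+n _ (postG N G s))
    eqH : ∀ s → M' s ≡ ((M s ∸ preG N G s) + postG N G s ∸ preG N H s) + postG N H s
    eqH s = begin
      M' s                                                     ≡⟨ eq s ⟩
      (M s ∸ preG N (G ++ H) s) + postG N (G ++ H) s           ≡⟨ cong₂ (λ p q → (M s ∸ p) + q) (preG-++ G H s) (postG-++ G H s) ⟩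
      (M s ∸ (preG N G s + preG N H s)) + (postG N G s + postG N H s)
        ≡⟨ ∸-+-split (M s) (preG N G s) (preG N H s) (postG N G s) (postG N H s) (total≤M s) ⟩
      ((M s ∸ preG N G s) + postG N G s ∸ preG N H s) + postG N H s ∎
      where open ≡-Reasoning

  Weak-snoc : ∀ {M σ M₁ a M₂} → Weak N M σ M₁ → LStep N M₁ (just a) M₂ → Weak N M (σ ++ a ∷ []) M₂
  Weak-snoc (nil τs)          last = cons τs last (nil done)
  Weak-snoc (cons τs first w) last = cons τs first (Weak-snoc w last)

  Enabled-pair : ∀ {M t v} → ¬ PresetsOverlap N t v →
                 (∀ s → pre s t ≤ M s) → (∀ s → pre s v ≤ M s) → Enabled N M (t ∷ v ∷ [])
  Enabled-pair {M} {t} {v} t∩v=∅ t≤M v≤M s =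
    +-≤-disjoint (pre s t) (pre s v + 0) (M s) (λ p q → t∩v=∅ (s , p , subst (0 <_) (+-identityʳ _) q))
                 (t≤M s) (subst (_≤ M s) (sym (+-identityʳ _)) (v≤M s))

  Enabled-single : ∀ {M t} → (∀ s → pre s t ≤ M s) → Enabled N M (t ∷ [])
  Enabled-single {M} t≤M s = subst (_≤ M s) (sym (+-identityʳ _)) (t≤M s)

  PresetsOverlap-within : ∀ {x y g h} → PresetsOverlap N x y →
                          g ≡ x ⊎ g ≡ y → h ≡ x ⊎ h ≡ y → PresetsOverlap N g h
  PresetsOverlap-within (s , x∋s , y∋s) (inj₁ refl) (inj₁ refl) = s , x∋s , x∋s
  PresetsOverlap-within (s , x∋s , y∋s) (inj₁ refl) (inj₂ refl) = s , x∋s , y∋s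
  PresetsOverlap-within (s , x∋s , y∋s) (inj₂ refl) (inj₁ refl) = s , y∋s , x∋s
  PresetsOverlap-within (s , x∋s , y∋s) (inj₂ refl) (inj₂ refl) = s , y∋s , y∋s

  After : List Act → Marking N → Set
  After σ M = ∃ λ M' → Weak N M₀ σ M' × M' ≗ M

  After-step : ∀ {σ M a M'} → After σ M → LStep N M (just a) M' → After (σ ++ a ∷ []) M'
  After-step (M₁ , w , M₁≗M) (t , ℓt , fires) =
    _ , Weak-snoc w (t , ℓt , Fires-respˡ-≗ {G = t ∷ []} (sym ∘ M₁≗M) fires) , λ s → refl

module _ {Act : Set} (N : Net Act) (plain : Plain N) where
  open Net N

  label : ∀ t → ∃ λ a → ℓ t ≡ just a
  label t with ℓ t in ℓt≡
  ... | just a  = a , refl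
  ... | nothing = ⊥-elim (proj₂ plain t ℓt≡)

  ¬τ-step : ∀ {M} → ¬ ∃ λ M' → LStep N M τ M'
  ¬τ-step (_ , t , ℓt≡τ , _) = proj₂ plain t ℓt≡τ

  TauStar⇒≗ : ∀ {M M'} → TauStar N M M' → M ≗ M'
  TauStar⇒≗ done                 s = refl
  TauStar⇒≗ (more (t , ℓt≡τ , _) _) = ⊥-elim (proj₂ plain t ℓt≡τ)

  Weak-deterministic : ∀ {M₁ M₂ σ M₁' M₂'} → M₁ ≗ M₂ →
                       Weak N M₁ σ M₁' → Weak N M₂ σ M₂' → M₁' ≗ M₂'
  Weak-deterministic M₁≗M₂ (nil τs₁) (nil τs₂) s =
    trans (sym (TauStar⇒≗ τs₁ s)) (trans (M₁≗M₂ s) (TauStar⇒≗ τs₂ s))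
  Weak-deterministic M₁≗M₂ (cons τs₁ (t , ℓt , fires₁) w₁) (cons τs₂ (u , ℓu , fires₂) w₂)
    with proj₁ plain t u (trans ℓt (sym ℓu))
  ... | refl = Weak-deterministic (Fires-deterministic N {G = t ∷ []} before fires₁ fires₂) w₁ w₂
    where
    before : _ ≗ _
    before s = trans (sym (TauStar⇒≗ τs₁ s)) (trans (M₁≗M₂ s) (TauStar⇒≗ τs₂ s))

  After-unique : ∀ {σ M M'} → After N σ M → Weak N M₀ σ M' → M' ≗ M
  After-unique (M₁ , w₁ , M₁≗M) w s = trans (Weak-deterministic (λ _ → refl) w w₁ s) (M₁≗M s)

  After-Fires : ∀ {σ M M'} G → After N σ M → Fires N M G M' → ∃ λ σ' → After N σ' M'
  After-Fires {σ} []      (M₁ , w , M₁≗M) (_ , eq) =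
    σ , M₁ , w , λ s → trans (M₁≗M s) (sym (trans (eq s) (+-identityʳ _)))
  After-Fires     (t ∷ G) after fires with Fires-++ N (t ∷ []) G fires
  ... | fires-t , fires-G = After-Fires G (After-step N after (t , proj₂ (label t) , fires-t)) fires-G

  Reachable⇒After : ∀ {M} → Reachable N M → ∃ λ σ → After N σ M
  Reachable⇒After init = [] , M₀ , nil done , λ s → refl
  Reachable⇒After (step {G = G} r fires) = After-Fires G (proj₂ (Reachable⇒After r)) fires

  InFailures⇒refuses : ∀ {σ M X} → After N σ M → InFailures N σ X → All (λ A → ¬ CanStep N M A) X
  InFailures⇒refuses after (M' , w , _ , refusals) =
    All.map (λ refuses → refuses ∘ CanStep-resp-≗ N (sym ∘ After-unique after w)) refusals

  refuses⇒InFailures : ∀ {σ M X} → After N σ M → All (λ A → ¬ CanStep N M A) X → InFailures N σ X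
  refuses⇒InFailures (M' , w , M'≗M) refusals =
    M' , w , ¬τ-step , All.map (λ refuses → refuses ∘ CanStep-resp-≗ N M'≗M) refusals

  label-∈-pair : ∀ {x y a b g} → ℓ x ≡ just a → ℓ y ≡ just b →
                 ℓ g ∈ (just a ∷ just b ∷ []) → g ≡ x ⊎ g ≡ y
  label-∈-pair {x} {g = g} ℓx ℓy (here ℓg)         = inj₁ (proj₁ plain g x (trans ℓg (sym ℓx)))
  label-∈-pair {y = y} {g = g} ℓx ℓy (there (here ℓg)) = inj₂ (proj₁ plain g y (trans ℓg (sym ℓy)))

  ¬CanStep-overlapping : StructuralConflict N → ∀ {M x y a b} → Reachable N M →
                         ℓ x ≡ just a → ℓ y ≡ just b → PresetsOverlap N x y → ¬ CanStep N M (a ∷ b ∷ [])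
  ¬CanStep-overlapping conflict r ℓx ℓy x∩y≠∅ (g ∷ h ∷ [] , en , ℓG↭ab) =
    conflict g h (_ , r , en)
      (PresetsOverlap-within N x∩y≠∅ (within (here refl)) (within (there (here refl))))
    where
    within : ∀ {k} → ℓ k ∈ map ℓ (g ∷ h ∷ []) → k ≡ _ ⊎ k ≡ _
    within k∈ = label-∈-pair ℓx ℓy (∈-resp-↭ ℓG↭ab k∈)
  ¬CanStep-overlapping _ _ _ _ _ ([]              , _ , ℓG↭ab) with () ← ↭-length ℓG↭ab
  ¬CanStep-overlapping _ _ _ _ _ (_ ∷ []          , _ , ℓG↭ab) with () ← ↭-length ℓG↭ab
  ¬CanStep-overlapping _ _ _ _ _ (_ ∷ _ ∷ _ ∷ _   , _ , ℓG↭ab) with () ← ↭-length ℓG↭ab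

lemma5p4 : {Act : Set} (N : Net Act) → Plain N → StructuralConflict N →
    FullyReachablePureM N →
    Σ (List Act) λ σ → Σ Act λ a → Σ Act λ b → Σ Act λ c →
      a ≢ c ×
      ¬ InFailures N σ ((a ∷ c ∷ []) ∷ []) ×
      ¬ InFailures N σ ((b ∷ []) ∷ []) ×
      InFailures N σ ((a ∷ b ∷ []) ∷ (b ∷ c ∷ []) ∷ [])
lemma5p4 N plain conflict (t , u , v , t∩u≠∅ , u∩v≠∅ , t∩v=∅ , M , reachable , bound)
  with Reachable⇒After N plain reachable | label N plain t | label N plain u | label N plain v
... | σ , after | a , ℓt | b , ℓu | c , ℓv =
  σ , a , b , c , a≢c ,
  (λ failure → All.head (InFailures⇒refuses N plain after failure)
                 (t ∷ v ∷ [] , Enabled-pair N t∩v=∅ t≤M v≤M , ↭-reflexive (cong₂ (λ p q → p ∷ q ∷ []) ℓt ℓv))) ,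
  (λ failure → All.head (InFailures⇒refuses N plain after failure)
                 (u ∷ [] , Enabled-single N u≤M , ↭-reflexive (cong (_∷ []) ℓu))) ,
  refuses⇒InFailures N plain after
    (¬CanStep-overlapping N plain conflict reachable ℓt ℓu t∩u≠∅ ∷
     ¬CanStep-overlapping N plain conflict reachable ℓu ℓv u∩v≠∅ ∷ [])
  where
  open Net N
  a≢c : a ≢ c
  a≢c refl with proj₁ plain t v (trans ℓt (sym ℓv))
  ... | refl = t∩v=∅ (PresetsOverlap-within N t∩u≠∅ (inj₁ refl) (inj₁ refl))
  t≤M : ∀ s → pre s t ≤ M s
  t≤M s = m⊔n≤o⇒m≤o (pre s t) (pre s u) (m⊔n≤o⇒m≤o _ (pre s v) (bound s))
  u≤M : ∀ s → pre s u ≤ M s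
  u≤M s = m⊔n≤o⇒n≤o (pre s t) (pre s u) (m⊔n≤o⇒m≤o _ (pre s v) (bound s))
  v≤M : ∀ s → pre s v ≤ M s
  v≤M s = m⊔n≤o⇒n≤o (pre s t ⊔ pre s u) (pre s v) (bound s)
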